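{- Let $G$ be a finite, simple, undirected, connected graph on $n\geq 3$ vertices with no pair of false-twin vertices. Then $G$ has at most $\lfloor \frac{n}{2} \rfloor$ vertices of degree one.
   Context: Two distinct vertices $u,v$ are false-twins if $N(u)=N(v)$, where $N(\cdot)$ denotes the open neighborhood. All graphs are assumed connected (standing assumption of the paper). -}

module Defs where

open import Data.Nat using (ℕ; zero; suc; _+_)
open import Data.Fin using (Fin)
open import Data.Bool using (Bool; true; false)
open import Data.List using (List; []; _∷_; length; filter; allFin)
open import Data.Product using (_×_; Σ; ∃)
open import Relation.Binary.PropositionalEquality using (_≡_; _≢_)
open import Relation.Nullary using (¬_)
open import Data.Nat using (_≟_)

record Graph (n : ℕ) : Set where
  field
    adj   : Fin n → Fin n → Bool
    sym   : ∀ u v → adj u v ≡ adj v u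
    irrefl : ∀ v → adj v v ≡ false
open Graph public

Adj : ∀ {n} → Graph n → Fin n → Fin n → Set
Adj G u v = adj G u v ≡ true

data Walk {n : ℕ} (G : Graph n) : Fin n → Fin n → Set where
  here : ∀ {u} → Walk G u u
  step : ∀ {u w v} → Adj G u w → Walk G w v → Walk G u v

Connected : ∀ {n} → Graph n → Set
Connected G = ∀ u v → Walk G u v

neighbours : ∀ {n} → Graph n → Fin n → List (Fin n)
neighbours {n} G v = filter (λ w → Data.Bool._≟_ (adj G v w) true) (allFin n)
  where import Data.Bool

degree : ∀ {n} → Graph n → Fin n → ℕ
degree G v = length (neighbours G v)

FalseTwins : ∀ {n} → Graph n → Fin n → Fin n → Set
FalseTwins G u v = u ≢ v × (∀ w → adj G u w ≡ adj G v w)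

NoFalseTwins : ∀ {n} → Graph n → Set
NoFalseTwins G = ∀ u v → ¬ FalseTwins G u v

numLeaves : ∀ {n} → Graph n → ℕ
numLeaves {n} G = length (filter (λ v → degree G v ≟ 1) (allFin n))

-- A leaf u has a unique neighbour, its support.  Two leaves with the same
-- support have the same neighbourhood, so without false twins the support map
-- is injective on leaves.  A leaf adjacent to another leaf would make the pair
-- a whole connected component, impossible for n ≥ 3; so no support is a leaf.
-- Hence the leaves and their supports are 2·(number of leaves) distinct vertices.
module Submission where

open import Defs renaming (sym to adj-sym)
open import Data.Nat as ℕ using (ℕ; _≤_; _/_; _+_; _*_)
open import Data.Bool as Bool using (true)
open import Data.Nat.Properties using (≤⇒≯; +-identityʳ; *-comm; module ≤-Reasoning)
open import Data.Nat.DivMod using (m*n/n≡m; /-monoˡ-≤)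
open import Data.Fin using (Fin; zero; suc; _≟_)
open import Data.Fin.Properties using (injective⇒≤)
open import Data.Bool.Properties using (⇔→≡)
open import Data.List using (List; []; _∷_; [_]; length; map; _++_; lookup; allFin; filter; head)
open import Data.List.Properties using (length-map; length-++)
open import Data.Maybe using (fromMaybe)
open import Data.List.Membership.Propositional using (_∈_)
open import Data.List.Membership.Propositional.Properties
  using (∈-filter⁺; ∈-filter⁻; ∈-allFin; ∈-map⁻; ∈-lookup)
open import Data.List.Relation.Unary.Any using (here)
open import Data.List.Relation.Unary.All as All using (All; []; _∷_)
open import Data.List.Relation.Unary.All.Properties as All using (all-filter)
open import Data.List.Relation.Unary.AllPairs using ([]; _∷_)
open import Data.List.Relation.Unary.Unique.Propositional using (Unique)
open import Data.List.Relation.Unary.Unique.Propositional.Properties using (++⁺; filter⁺; allFin⁺)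
open import Data.List.Relation.Binary.Disjoint.Propositional using (Disjoint)
open import Data.Product using (_,_)
open import Data.Sum using (_⊎_; inj₁; inj₂)
open import Function.Bundles using (_⇔_; mk⇔; Equivalence)
open import Relation.Nullary using (¬_; Dec; contradiction)
open import Relation.Nullary.Decidable using (decidable-stable)
open import Relation.Unary using (Pred)
open import Relation.Binary.PropositionalEquality
  using (_≡_; refl; sym; trans; cong; subst)

open Equivalence using (to; from)

Unique⇒lookup-injective : ∀ {a} {A : Set a} {xs : List A} → Unique xs →
                          ∀ {i j} → lookup xs i ≡ lookup xs j → i ≡ j
Unique⇒lookup-injective (_ ∷ _)    {zero}  {zero}  _ = refl
Unique⇒lookup-injective (x∉xs ∷ _) {zero}  {suc j} e = contradiction e (All.lookup x∉xs (∈-lookup j))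
Unique⇒lookup-injective (x∉xs ∷ _) {suc i} {zero}  e = contradiction (sym e) (All.lookup x∉xs (∈-lookup i))
Unique⇒lookup-injective (_ ∷ u)    {suc i} {suc j} e = cong suc (Unique⇒lookup-injective u e)

Unique⇒length≤ : ∀ {n} {xs : List (Fin n)} → Unique xs → length xs ≤ n
Unique⇒length≤ u = injective⇒≤ (Unique⇒lookup-injective u)

Unique-map⁺-on : ∀ {a b p} {A : Set a} {B : Set b} {P : Pred A p} {f : A → B} {xs : List A} →
                 (∀ {x y} → P x → P y → f x ≡ f y → x ≡ y) →
                 All P xs → Unique xs → Unique (map f xs)
Unique-map⁺-on f-inj []         []            = []
Unique-map⁺-on f-inj (px ∷ pxs) (x∉xs ∷ u) =
  All.map⁺ (All.zipWith (λ (x≢y , py) fx≡fy → x≢y (f-inj px py fx≡fy)) (x∉xs , pxs))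
  ∷ Unique-map⁺-on f-inj pxs u

cover₂⇒n≤2 : ∀ {n} (u v : Fin n) → (∀ w → w ≡ u ⊎ w ≡ v) → n ≤ 2
cover₂⇒n≤2 {n} u v cover =
  injective⇒≤ {f = λ w → side (cover w)} (λ {w} {w′} → side-injective (cover w) (cover w′))
  where
  side : ∀ {w} → w ≡ u ⊎ w ≡ v → Fin 2
  side (inj₁ _) = zero
  side (inj₂ _) = suc zero

  side-injective : ∀ {w w′} (p : w ≡ u ⊎ w ≡ v) (q : w′ ≡ u ⊎ w′ ≡ v) → side p ≡ side q → w ≡ w′
  side-injective (inj₁ refl) (inj₁ refl) _ = refl
  side-injective (inj₂ refl) (inj₂ refl) _ = refl
  side-injective (inj₁ _)    (inj₂ _)    ()
  side-injective (inj₂ _)    (inj₁ _)    ()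

length≡1⇒≡[head] : ∀ {a} {A : Set a} (d : A) {xs : List A} → length xs ≡ 1 → xs ≡ [ fromMaybe d (head xs) ]
length≡1⇒≡[head] d {_ ∷ []} _ = refl

m+m≤n⇒m≤n/2 : ∀ {m n} → m + m ≤ n → m ≤ n / 2
m+m≤n⇒m≤n/2 {m} {n} m+m≤n = begin
  m         ≡⟨ m*n/n≡m m 2 ⟨
  m * 2 / 2 ≤⟨ /-monoˡ-≤ 2 (subst (_≤ n) m+m≡m*2 m+m≤n) ⟩
  n / 2     ∎
  where
  open ≤-Reasoning
  m+m≡m*2 : m + m ≡ m * 2
  m+m≡m*2 = trans (cong (m +_) (sym (+-identityʳ m))) (*-comm 2 m)

module _ {n : ℕ} (G : Graph n) where

  Walk-closed : ∀ {p} {P : Pred (Fin n) p} → (∀ {x y} → P x → Adj G x y → P y) →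
                ∀ {x y} → Walk G x y → P x → P y
  Walk-closed closed here         px = px
  Walk-closed closed (step xz zy) px = Walk-closed closed zy (closed px xz)

  ∈-neighbours⇔Adj : ∀ {v w} → w ∈ neighbours G v ⇔ Adj G v w
  ∈-neighbours⇔Adj {v} {w} = mk⇔
    (λ w∈ → let _ , vw = ∈-filter⁻ adjacent? {xs = allFin n} w∈ in vw)
    (∈-filter⁺ adjacent? (∈-allFin w))
    where
    adjacent? : ∀ w → Dec (adj G v w ≡ true)
    adjacent? w = adj G v w Bool.≟ true

  Leaf : Fin n → Set
  Leaf v = degree G v ≡ 1

  leaves : List (Fin n)
  leaves = filter (λ v → degree G v ℕ.≟ 1) (allFin n)

  -- The default v is junk: support is only ever applied to leaves.
  support : Fin n → Fin n
  support v = fromMaybe v (head (neighbours G v))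

  Leaf⇒Adj⇔≡support : ∀ {v w} → Leaf v → Adj G v w ⇔ w ≡ support v
  Leaf⇒Adj⇔≡support {v} {w} leaf = mk⇔ Adj⇒≡ ≡⇒Adj
    where
    neighbours≡ : neighbours G v ≡ [ support v ]
    neighbours≡ = length≡1⇒≡[head] v leaf

    Adj⇒≡ : Adj G v w → w ≡ support v
    Adj⇒≡ vw with subst (w ∈_) neighbours≡ (from ∈-neighbours⇔Adj vw)
    ... | here w≡s = w≡s

    ≡⇒Adj : w ≡ support v → Adj G v w
    ≡⇒Adj refl = to ∈-neighbours⇔Adj (subst (support v ∈_) (sym neighbours≡) (here refl))

  support-injective : NoFalseTwins G → ∀ {u v} → Leaf u → Leaf v → support u ≡ support v → u ≡ v
  support-injective noTwins {u} {v} leaf-u leaf-v su≡sv =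
    decidable-stable (u ≟ v) (λ u≢v → noTwins u v (u≢v , λ w → ⇔→≡ (same-neighbours w)))
    where
    same-neighbours : ∀ w → Adj G u w ⇔ Adj G v w
    same-neighbours w = mk⇔
      (λ uw → from (Leaf⇒Adj⇔≡support leaf-v) (trans (to (Leaf⇒Adj⇔≡support leaf-u) uw) su≡sv))
      (λ vw → from (Leaf⇒Adj⇔≡support leaf-u) (trans (to (Leaf⇒Adj⇔≡support leaf-v) vw) (sym su≡sv)))

  support-of-Leaf-not-Leaf : Connected G → 3 ≤ n → ∀ {u} → Leaf u → ¬ Leaf (support u)
  support-of-Leaf-not-Leaf connected 3≤n {u} leaf-u leaf-s =
    ≤⇒≯ (cover₂⇒n≤2 u s (λ w → Walk-closed closed (connected u w) (inj₁ refl))) 3≤n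
    where
    s : Fin n
    s = support u

    s∼u : Adj G s u
    s∼u = trans (adj-sym G s u) (from (Leaf⇒Adj⇔≡support leaf-u) refl)

    closed : ∀ {x y} → x ≡ u ⊎ x ≡ s → Adj G x y → y ≡ u ⊎ y ≡ s
    closed (inj₁ refl) uy = inj₂ (to (Leaf⇒Adj⇔≡support leaf-u) uy)
    closed (inj₂ refl) sy = inj₁ (trans (to (Leaf⇒Adj⇔≡support leaf-s) sy)
                                        (sym (to (Leaf⇒Adj⇔≡support leaf-s) s∼u)))

lemma3p3 : (n : ℕ) → 3 ≤ n → (G : Graph n) → Connected G → NoFalseTwins G →
    numLeaves G ≤ n / 2
lemma3p3 n 3≤n G connected noTwins = m+m≤n⇒m≤n/2 (begin
  k + k                                   ≡⟨ cong (k +_) (length-map (support G) ls) ⟨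
  length ls + length (map (support G) ls) ≡⟨ length-++ ls ⟨
  length (ls ++ map (support G) ls)       ≤⟨ Unique⇒length≤ unique ⟩
  n                                       ∎)
  where
  open ≤-Reasoning
  ls : List (Fin n)
  ls = leaves G

  k : ℕ
  k = length ls

  ls-unique : Unique ls
  ls-unique = filter⁺ _ (allFin⁺ n)

  ls-Leaf : All (Leaf G) ls
  ls-Leaf = all-filter _ (allFin n)

  disjoint : Disjoint ls (map (support G) ls)
  disjoint (v∈ls , v∈supports) with ∈-map⁻ (support G) v∈supports
  ... | u , u∈ls , refl =
    support-of-Leaf-not-Leaf G connected 3≤n (All.lookup ls-Leaf u∈ls) (All.lookup ls-Leaf v∈ls)

  unique : Unique (ls ++ map (support G) ls)
  unique = ++⁺ ls-unique (Unique-map⁺-on (support-injective G noTwins) ls-Leaf ls-unique) disjoint
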